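{- If $\Gamma=\mathrm{AG}(2,q)$ with $q\ge 4$ or $\Gamma=\mathrm{PG}(2,q)$ with $q\ge 3$, then every rank two residue of the triangle complex $\Delta(\Gamma)$ has gonality $3$, and both of its diameters are equal to $4$.
   Context: $\mathrm{AG}(2,q)$ and $\mathrm{PG}(2,q)$ denote the affine and projective planes over $\mathrm{GF}(q)$ viewed as rank two geometries of points and lines. Triangle complex: $\Delta(\Gamma)$ is the rank three incidence system over $\{1,2,3\}$ whose elements are the triples $(p,L,i)$ with $p$ incident with $L$ and $i\in\{1,2,3\}$; the type of $(p,L,i)$ is $i$; and $(p,L,i)$ is incident with $(p',L',i \bmod 3+1)$ if and only if the set of points incident with both $L$ and $L'$ is exactly $\{p\}$ and $p\neq p'$ (incidence symmetric and reflexive, no other incidences). A rank two residue is the set of elements incident with a single given element $x$, other than $x$, with the induced incidence. For a rank two geometry with types $a,b$ and incidence graph (edges between incident elements of different types), the gonality is half the length of a shortest circuit; the $a$-diameter (resp. $b$-diameter) is the largest distance in the incidence graph from an element of type $a$ (resp. $b$) to any element. -}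

module Defs where

open import Data.Nat using (ℕ; zero; suc; _≤_; _<_; _*_)
open import Data.Fin using (Fin; zero; suc; inject₁; fromℕ)
open import Data.Product using (Σ; _×_; _,_; ∃)
open import Data.Sum using (_⊎_; inj₁; inj₂)
open import Data.Unit using (⊤; tt)
open import Relation.Nullary using (¬_)
open import Relation.Binary.PropositionalEquality using (_≡_)
open import Algebra.Core using (Op₁; Op₂)
open import Algebra.Structures using (IsCommutativeRing)
open import Function.Bundles using (_↔_)
open import Function.Definitions using (Injective)

-- A finite field with exactly q elements (GF(q) is unique up to
-- isomorphism, so we quantify over all such fields).

record FiniteField (q : ℕ) : Set₁ where
  field
    Carrier : Set
    _+_ _·_ : Op₂ Carrier
    -_      : Op₁ Carrier
    0# 1#   : Carrier
    isCommutativeRing : IsCommutativeRing _≡_ _+_ _·_ -_ 0# 1#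
    0≢1     : ¬ (0# ≡ 1#)
    inverse : ∀ x → ¬ (x ≡ 0#) → Σ Carrier (λ y → x · y ≡ 1#)
    enum    : Fin q ↔ Carrier

record PLGeometry : Set₁ where
  field
    Point : Set
    Line  : Set
    _I_   : Point → Line → Set

AG : ∀ {q} → FiniteField q → PLGeometry
AG F = record { Point = Carrier × Carrier ; Line = (Carrier × Carrier) ⊎ Carrier ; _I_ = inc }
  where
  open FiniteField F
  inc : Carrier × Carrier → (Carrier × Carrier) ⊎ Carrier → Set
  inc (x , y) (inj₁ (m , c)) = y ≡ (m · x) + c
  inc (x , y) (inj₂ c)       = x ≡ c

-- PG(2,F): points and lines are both represented by normalised
-- homogeneous coordinates (1,a,b), (0,1,a), (0,0,1); a point lies on a
-- line iff the dot product of their coordinate vectors is zero.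
ProjRep : Set → Set
ProjRep C = (C × C) ⊎ (C ⊎ ⊤)

PG : ∀ {q} → FiniteField q → PLGeometry
PG F = record { Point = ProjRep Carrier ; Line = ProjRep Carrier ; _I_ = inc }
  where
  open FiniteField F
  coords : ProjRep Carrier → Carrier × Carrier × Carrier
  coords (inj₁ (a , b))   = 1# , a , b
  coords (inj₂ (inj₁ a))  = 0# , 1# , a
  coords (inj₂ (inj₂ tt)) = 0# , 0# , 1#
  dot : Carrier × Carrier × Carrier → Carrier × Carrier × Carrier → Carrier
  dot (x₀ , x₁ , x₂) (y₀ , y₁ , y₂) = ((x₀ · y₀) + (x₁ · y₁)) + (x₂ · y₂)
  inc : ProjRep Carrier → ProjRep Carrier → Set
  inc p L = dot (coords p) (coords L) ≡ 0#

-- Triangle complex Δ(Γ).  Types {1,2,3} are represented by Fin 3 = {0,1,2}.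

next : Fin 3 → Fin 3
next zero             = suc zero
next (suc zero)       = suc (suc zero)
next (suc (suc zero)) = zero

module Triangle (Γ : PLGeometry) where
  open PLGeometry Γ

  Elem : Set
  Elem = Point × Line × Fin 3

  Valid : Elem → Set
  Valid (p , L , i) = p I L

  type : Elem → Fin 3
  type (p , L , i) = i

  MeetExactly : Line → Line → Point → Set
  MeetExactly L L' p = p I L × p I L' × (∀ r → r I L → r I L' → r ≡ p)

  Step : Elem → Elem → Set
  Step (p , L , i) (p' , L' , j) = j ≡ next i × MeetExactly L L' p × ¬ (p ≡ p')

  Inc : Elem → Elem → Set
  Inc x y = x ≡ y ⊎ (Step x y ⊎ Step y x)

  InRes : Elem → Elem → Set
  InRes x y = Valid y × ¬ (y ≡ x) × Inc x y

  Adj : Elem → Elem → Set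
  Adj y z = Inc y z × ¬ (type y ≡ type z)

module Graph {V : Set} (In : V → Set) (Adj : V → V → Set) where

  data Walk : V → V → ℕ → Set where
    here  : ∀ {y} → In y → Walk y y 0
    step  : ∀ {y z w n} → In y → Adj y z → Walk z w n → Walk y w (suc n)

  Circuit : ℕ → Set
  Circuit zero    = Data.Empty.⊥
    where import Data.Empty
  Circuit (suc m) =
    3 ≤ suc m ×
    Σ (Fin (suc m) → V) λ f →
      (∀ i → In (f i)) × Injective _≡_ _≡_ f ×
      (∀ (i : Fin m) → Adj (f (inject₁ i)) (f (suc i))) ×
      Adj (f (fromℕ m)) (f zero)

  HasGonality : ℕ → Set
  HasGonality g = Circuit (2 * g) × (∀ n → Circuit n → 2 * g ≤ n)

  Dist≡ : V → V → ℕ → Set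
  Dist≡ y w d = Walk y w d × (∀ k → k < d → ¬ Walk y w k)

  HasDiameter : (V → Set) → ℕ → Set
  HasDiameter P d =
    (∀ y w → In y → P y → In w → Σ ℕ λ k → k ≤ d × Walk y w k) ×
    Σ V λ y → Σ V λ w → In y × P y × In w × Dist≡ y w d

ResidueProperty : PLGeometry → Set
ResidueProperty Γ =
  ∀ (x : Elem) → Valid x →
    HasGonality (InRes x) Adj 3 ×
    (∀ (t : Fin 3) → ¬ (t ≡ type x) → HasDiameter (InRes x) Adj (λ y → type y ≡ t) 4)
  where
  open Triangle Γ
  open Graph

-- Fix a flag (p, L) of type i. Its residue splits into the elements of type i+1, which are
-- determined by a point a off L (their line is pa), and those of type i-1, which are determined
-- by a line B meeting L in a single point b ≠ p; adjacency is just a ∈ B. So the residue is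
-- bipartite, and as two points lie on at most one line it has no 4-circuits, while a triangle
-- with vertices off L and sides meeting L away from p is a 6-circuit. A point a off L reaches
-- any such line B in at most three steps, through a point of B off L, off pa and off the one
-- line through a that may miss L; hence all distances are at most 4. Two points of a line
-- through p, or two lines through a point of L, have no common neighbour, so they are at
-- distance exactly 4. Only incidence axioms shared by AG(2,q), q ≥ 4, and PG(2,q), q ≥ 3, are
-- used, chiefly that every line has at least four points.

module Submission where

open import Defs
open import Algebra.Bundles using (CommutativeRing)
open import Data.Bool.Base using (Bool; true; false; not)
open import Data.Bool.Properties using (not-¬; not-involutive)
open import Data.Empty using (⊥)
open import Data.Fin.Base as Fin using (Fin; zero; suc; inject₁; inject≤)
open import Data.Fin.Properties as Fin using (pigeonhole; any?; <⇒≢)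
open import Data.Integer.Base as ℤ using (ℤ; +_; -[1+_]; _⊖_; _◃_; 0ℤ; 1ℤ; +-*-rawRing)
import Data.Integer.Properties as ℤ
open import Data.List.Base as List using (List; []; _∷_; length)
open import Data.List.Relation.Unary.All using (All; []; _∷_; lookupAny)
open import Data.List.Relation.Unary.All.Properties using (¬Any⇒All¬)
open import Data.List.Relation.Unary.Any as Any using (Any)
open import Data.List.Relation.Unary.Any.Properties using (lookup-result)
open import Data.Maybe.Base using (map)
open import Data.Nat.Base as ℕ using (ℕ; zero; suc; _≤_; _<_; z≤n; s≤s)
import Data.Nat.Properties as ℕ
open import Data.Product using (Σ; ∃; ∃₂; _×_; _,_; proj₁; proj₂)
import Data.Product.Properties as ×
open import Data.Sign.Base as Sign using (Sign)
open import Data.Sum using (_⊎_; inj₁; inj₂; [_,_]′)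
import Data.Sum.Properties as ⊎
open import Data.Unit using (tt)
import Data.Unit.Properties as ⊤
open import Data.Vec.Base as Vec using (Vec; []; _∷_)
open import Data.Vec.Relation.Unary.All as VecAll using ([]; _∷_)
open import Data.Vec.Relation.Unary.All.Properties using (lookup⁺)
open import Data.Vec.Relation.Unary.AllPairs using ([]; _∷_)
open import Data.Vec.Relation.Unary.Unique.Propositional using (Unique)
open import Data.Vec.Relation.Unary.Unique.Propositional.Properties using (lookup-injective)
open import Function.Base using (_∘_)
open import Function.Bundles using (Injection)
open import Function.Definitions using (Injective)
open import Function.Properties.Inverse using (↔⇒↣; ↔-sym)
open import Relation.Binary.Definitions using (DecidableEquality)
open import Relation.Binary.PropositionalEquality
  using (_≡_; _≢_; refl; sym; trans; cong; cong₂; subst; module ≡-Reasoning)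
open import Relation.Nullary using (¬_; Dec; yes; no; ¬?; contradiction)
open import Relation.Nullary.Decidable using (decidable-stable; dec⇒maybe; via-injection)
open import Algebra.Solver.Ring.AlmostCommutativeRing using (_-Raw-AlmostCommutative⟶_; fromCommutativeRing)

next³ : ∀ i → next (next (next i)) ≡ i
next³ zero             = refl
next³ (suc zero)       = refl
next³ (suc (suc zero)) = refl

next≢id : ∀ i → next i ≢ i
next≢id zero             ()
next≢id (suc zero)       ()
next≢id (suc (suc zero)) ()

next²≢id : ∀ i → next (next i) ≢ i
next²≢id zero             ()
next²≢id (suc zero)       ()
next²≢id (suc (suc zero)) ()

≢⇒next⊎next² : ∀ {i t} → t ≢ i → t ≡ next i ⊎ t ≡ next (next i)
≢⇒next⊎next² {zero}             {zero}             t≢i = contradiction refl t≢i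
≢⇒next⊎next² {zero}             {suc zero}         t≢i = inj₁ refl
≢⇒next⊎next² {zero}             {suc (suc zero)}   t≢i = inj₂ refl
≢⇒next⊎next² {suc zero}         {zero}             t≢i = inj₂ refl
≢⇒next⊎next² {suc zero}         {suc zero}         t≢i = contradiction refl t≢i
≢⇒next⊎next² {suc zero}         {suc (suc zero)}   t≢i = inj₁ refl
≢⇒next⊎next² {suc (suc zero)}   {zero}             t≢i = inj₁ refl
≢⇒next⊎next² {suc (suc zero)}   {suc zero}         t≢i = inj₂ refl
≢⇒next⊎next² {suc (suc zero)}   {suc (suc zero)}   t≢i = contradiction refl t≢i

module WalkProperties {V : Set} {In : V → Set} {Adj : V → V → Set} where
  open Graph In Adj

  walk-source : ∀ {y w n} → Walk y w n → In y
  walk-source (here y∈)     = y∈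
  walk-source (step y∈ _ _) = y∈

  walk-snoc : ∀ {y w u n} → Walk y w n → Adj w u → In u → Walk y u (suc n)
  walk-snoc (here w∈)        w~u u∈ = step w∈ w~u (here u∈)
  walk-snoc (step y∈ y~z wk) w~u u∈ = step y∈ y~z (walk-snoc wk w~u u∈)

  walk-reverse : (∀ {y z} → Adj y z → Adj z y) → ∀ {y w n} → Walk y w n → Walk w y n
  walk-reverse symmetric (here y∈)        = here y∈
  walk-reverse symmetric (step y∈ y~z wk) = walk-snoc (walk-reverse symmetric wk) (symmetric y~z) y∈

flips : ℕ → Bool → Bool
flips zero    b = b
flips (suc n) b = flips n (not b)

flips-double : ∀ n b → flips (n ℕ.+ n) b ≡ b
flips-double zero    b = refl
flips-double (suc n) b = begin
  flips (n ℕ.+ suc n) (not b)    ≡⟨ cong (λ k → flips k (not b)) (ℕ.+-suc n n) ⟩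
  flips (n ℕ.+ n) (not (not b))  ≡⟨ flips-double n (not (not b)) ⟩
  not (not b)                    ≡⟨ not-involutive b ⟩
  b                              ∎
  where open ≡-Reasoning

module TriangleComplexProperties (Γ : PLGeometry) where
  open PLGeometry Γ
  open Triangle Γ

  point : Elem → Point
  point (a , _ , _) = a

  line : Elem → Line
  line (_ , M , _) = M

  Adj-sym : ∀ {y z} → Adj y z → Adj z y
  Adj-sym (inj₁ y≡z , ≢type)      = inj₁ (sym y≡z) , ≢type ∘ sym
  Adj-sym (inj₂ (inj₁ s) , ≢type) = inj₂ (inj₂ s) , ≢type ∘ sym
  Adj-sym (inj₂ (inj₂ s) , ≢type) = inj₂ (inj₁ s) , ≢type ∘ sym

record PlaneAxioms (Γ : PLGeometry) : Set where
  open PLGeometry Γ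
  field
    _≟_         : DecidableEquality Point
    _I?_        : ∀ a M → Dec (a I M)
    join        : ∀ {a b} → a ≢ b → Σ Line λ M → a I M × b I M
    join-unique : ∀ {a b M N} → a ≢ b → a I M → b I M → a I N → b I N → M ≡ N
    -- every line through a other than Q meets K; in a projective plane any Q will do
    parallel    : ∀ a K → Σ Line λ Q → a I Q × (∀ {M} → a I M → M ≢ Q → ∃ λ b → b I M × b I K)
    four-points : ∀ M → Σ (Fin 4 → Point) λ f → (∀ k → f k I M) × Injective _≡_ _≡_ f
    point-off   : ∀ M → ∃ λ a → ¬ a I M

module PlaneProperties {Γ : PLGeometry} (Π : PlaneAxioms Γ) where
  open PLGeometry Γ
  open PlaneAxioms Π

  separates-points : ∀ {a b M} → a I M → ¬ b I M → a ≢ b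
  separates-points a∈M b∉M refl = b∉M a∈M

  separates-lines : ∀ {a M N} → a I M → ¬ a I N → N ≢ M
  separates-lines a∈M a∉N refl = a∉N a∈M

  meet-unique : ∀ {a b M N} → M ≢ N → a I M → a I N → b I M → b I N → a ≡ b
  meet-unique {a} {b} M≢N a∈M a∈N b∈M b∈N with a ≟ b
  ... | yes a≡b = a≡b
  ... | no  a≢b = contradiction (join-unique a≢b a∈M b∈M a∈N b∈N) M≢N

  avoid : ∀ M (Ns : List Line) → length Ns < 4 → All (M ≢_) Ns →
          ∃ λ c → c I M × All (λ N → ¬ c I N) Ns
  avoid M Ns short M∉Ns with four-points M
  ... | f , f∈M , f-inj with any? (λ k → ¬? (Any.any? (f k I?_) Ns))
  ...   | yes (k , misses) = f k , f∈M k , ¬Any⇒All¬ Ns misses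
  ...   | no all-hit = collision (pigeonhole short (Any.index ∘ hit))
    where
    hit : ∀ k → Any (f k I_) Ns
    hit k = decidable-stable (Any.any? (f k I?_) Ns) (λ misses → all-hit (k , misses))

    collision : ∃₂ (λ i j → i Fin.< j × Any.index (hit i) ≡ Any.index (hit j)) →
                ∃ λ c → c I M × All (λ N → ¬ c I N) Ns
    collision (i , j , i<j , same) with lookupAny M∉Ns (hit i)
    ... | M≢N , fi∈N = contradiction (join-unique (<⇒≢ i<j ∘ f-inj) (f∈M i) (f∈M j) fi∈N fj∈N) M≢N
      where
      fj∈N : f j I Any.lookup (hit i)
      fj∈N = subst (f j I_) (cong (List.lookup Ns) (sym same)) (lookup-result (hit j))

  open Triangle Γ
  open TriangleComplexProperties Γ

  module Residue {p L} (p∈L : p I L) (i : Fin 3) where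
    x : Elem
    x = p , L , i

    open Graph (InRes x) Adj
    open WalkProperties {In = InRes x} {Adj = Adj}

    -- the elements y with Step x y, resp. Step y x, described geometrically
    Forward : Elem → Set
    Forward (a , A , j) = j ≡ next i × ¬ a I L × a I A × p I A

    Backward : Elem → Set
    Backward (b , B , j) = j ≡ next (next i) × b I L × b I B × ¬ p I B

    Side : Elem → Set
    Side y = Forward y ⊎ Backward y

    isForward : ∀ {y} → Side y → Bool
    isForward (inj₁ _) = true
    isForward (inj₂ _) = false

    forward-in-residue : ∀ {y} → Forward y → InRes x y
    forward-in-residue {a , A , _} (refl , a∉L , a∈A , p∈A) =
      a∈A , next≢id i ∘ cong type ,
      inj₂ (inj₁ (refl , (p∈L , p∈A , only-p) , separates-points p∈L a∉L))
      where
      only-p : ∀ r → r I L → r I A → r ≡ p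
      only-p r r∈L r∈A = meet-unique (separates-lines a∈A a∉L) r∈L r∈A p∈L p∈A

    backward-in-residue : ∀ {y} → Backward y → InRes x y
    backward-in-residue {b , B , _} (refl , b∈L , b∈B , p∉B) =
      b∈B , next²≢id i ∘ cong type ,
      inj₂ (inj₂ (sym (next³ i) , (b∈B , b∈L , only-b) , separates-points b∈B p∉B))
      where
      only-b : ∀ r → r I B → r I L → r ≡ b
      only-b r r∈B r∈L = meet-unique (separates-lines p∈L p∉B) r∈B r∈L b∈B b∈L

    residue-side : ∀ {y} → InRes x y → Side y
    residue-side (_ , y≢x , inj₁ x≡y) = contradiction (sym x≡y) y≢x
    residue-side {a , A , j} (a∈A , _ , inj₂ (inj₁ (j≡ , (_ , p∈A , only-p) , p≢a))) =
      inj₁ (j≡ , (λ a∈L → p≢a (sym (only-p a a∈L a∈A))) , a∈A , p∈A)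
    residue-side {b , B , j} (b∈B , _ , inj₂ (inj₂ (i≡ , (_ , b∈L , only-b) , b≢p))) =
      inj₂ (trans (sym (next³ j)) (cong (next ∘ next) (sym i≡)) , b∈L , b∈B ,
            λ p∈B → b≢p (sym (only-b p p∈B p∈L)))

    incident⇒adjacent : ∀ {y z} → Forward y → Backward z → point y I line z → Adj y z
    incident⇒adjacent {a , A , _} {b , B , _} (refl , a∉L , a∈A , p∈A) (refl , b∈L , b∈B , p∉B) a∈B =
      inj₂ (inj₁ (refl , (a∈A , a∈B , only-a) , separates-points b∈L a∉L ∘ sym)) ,
      next≢id (next i) ∘ sym
      where
      only-a : ∀ r → r I A → r I B → r ≡ a
      only-a r r∈A r∈B = meet-unique (separates-lines p∈A p∉B ∘ sym) r∈A r∈B a∈A a∈B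

    adjacent⇒incident : ∀ {y z} → Forward y → Backward z → Adj y z → point y I line z
    adjacent⇒incident _ _ (inj₁ y≡z , ≢type) = contradiction (cong type y≡z) ≢type
    adjacent⇒incident _ _ (inj₂ (inj₁ (_ , (_ , a∈B , _) , _)) , _) = a∈B
    adjacent⇒incident {_ , _ , _} {_ , _ , _} (refl , _) (refl , _) (inj₂ (inj₂ (≡next , _)) , _) =
      contradiction (trans ≡next (next³ i)) (next≢id i)

    forwards-not-adjacent : ∀ {y z} → Forward y → Forward z → ¬ Adj y z
    forwards-not-adjacent {_ , _ , _} {_ , _ , _} (refl , _) (refl , _) (_ , ≢type) = ≢type refl

    backwards-not-adjacent : ∀ {y z} → Backward y → Backward z → ¬ Adj y z
    backwards-not-adjacent {_ , _ , _} {_ , _ , _} (refl , _) (refl , _) (_ , ≢type) = ≢type refl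

    neighbour-of-forward : ∀ {y z} → Forward y → InRes x z → Adj y z → Backward z
    neighbour-of-forward fy z∈ y~z with residue-side z∈
    ... | inj₁ fz = contradiction y~z (forwards-not-adjacent fy fz)
    ... | inj₂ bz = bz

    neighbour-of-backward : ∀ {y z} → Backward y → InRes x z → Adj y z → Forward z
    neighbour-of-backward by z∈ y~z with residue-side z∈
    ... | inj₁ fz = fz
    ... | inj₂ bz = contradiction y~z (backwards-not-adjacent by bz)

    forward-not-backward : ∀ {y} → Forward y → ¬ Backward y
    forward-not-backward {_ , _ , _} (refl , _) (next≡next² , _) = next≢id (next i) (sym next≡next²)

    forward≢backward : ∀ {y z} → Forward y → Backward z → y ≢ z
    forward≢backward fy bz refl = forward-not-backward fy bz

    isForward-unique : ∀ {y} (s t : Side y) → isForward s ≡ isForward t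
    isForward-unique (inj₁ _)  (inj₁ _)  = refl
    isForward-unique (inj₂ _)  (inj₂ _)  = refl
    isForward-unique (inj₁ fy) (inj₂ by) = contradiction by (forward-not-backward fy)
    isForward-unique (inj₂ by) (inj₁ fy) = contradiction by (forward-not-backward fy)

    adjacent-isForward : ∀ {y z} (s : Side y) (t : Side z) → Adj y z → isForward t ≡ not (isForward s)
    adjacent-isForward (inj₁ fy) (inj₁ fz) y~z = contradiction y~z (forwards-not-adjacent fy fz)
    adjacent-isForward (inj₁ _)  (inj₂ _)  _   = refl
    adjacent-isForward (inj₂ _)  (inj₁ _)  _   = refl
    adjacent-isForward (inj₂ by) (inj₂ bz) y~z = contradiction y~z (backwards-not-adjacent by bz)

    walk-isForward : ∀ {y w n} (s : Side y) (t : Side w) → Walk y w n → isForward t ≡ flips n (isForward s)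
    walk-isForward s t (here _)         = isForward-unique t s
    walk-isForward s t (step {n = n} _ y~z wk) =
      trans (walk-isForward (residue-side (walk-source wk)) t wk)
            (cong (flips n) (adjacent-isForward s (residue-side (walk-source wk)) y~z))

    no-odd-walk : ∀ {y w} n (s : Side y) (t : Side w) → isForward s ≡ isForward t → ¬ Walk y w (suc (n ℕ.+ n))
    no-odd-walk n s t same wk =
      not-¬ refl (trans same (trans (walk-isForward s t wk) (flips-double n (not (isForward s)))))

    forward-unique : ∀ {y y′} → Forward y → Forward y′ → point y ≡ point y′ → y ≡ y′
    forward-unique {a , A , _} {_ , A′ , _} (refl , a∉L , a∈A , p∈A) (refl , _ , a∈A′ , p∈A′) refl =
      cong (λ M → a , M , next i) (join-unique (separates-points p∈L a∉L) p∈A a∈A p∈A′ a∈A′)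

    backward-unique : ∀ {z z′} → Backward z → Backward z′ → line z ≡ line z′ → z ≡ z′
    backward-unique {b , B , _} {b′ , _ , _} (refl , b∈L , b∈B , p∉B) (refl , b′∈L , b′∈B , _) refl =
      cong (λ c → c , B , next (next i)) (meet-unique (separates-lines p∈L p∉B) b∈B b∈L b′∈B b′∈L)

    common-neighbour-unique : ∀ {y y′ z z′} → Forward y → Forward y′ → y ≢ y′ → InRes x z → InRes x z′ →
                              Adj y z → Adj y′ z → Adj y z′ → Adj y′ z′ → z ≡ z′
    common-neighbour-unique fy fy′ y≢y′ z∈ z′∈ y~z y′~z y~z′ y′~z′ =
      backward-unique bz bz′
        (join-unique (y≢y′ ∘ forward-unique fy fy′)
          (adjacent⇒incident fy bz y~z) (adjacent⇒incident fy′ bz y′~z)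
          (adjacent⇒incident fy bz′ y~z′) (adjacent⇒incident fy′ bz′ y′~z′))
      where
      bz  = neighbour-of-forward fy z∈ y~z
      bz′ = neighbour-of-forward fy z′∈ y~z′

    no-circuit-3 : ¬ Circuit 3
    no-circuit-3 (_ , f , f∈ , _ , f~ , closing) = no-odd-walk 1 s s refl closed
      where
      s = residue-side (f∈ zero)
      closed : Walk (f zero) (f zero) 3
      closed = step (f∈ zero) (f~ zero) (step (f∈ (suc zero)) (f~ (suc zero))
                 (step (f∈ (suc (suc zero))) closing (here (f∈ zero))))

    no-circuit-4 : ¬ Circuit 4
    no-circuit-4 (_ , f , f∈ , f-inj , f~ , closing) with residue-side (f∈ zero)
    ... | inj₁ f₀ =
      contradiction (f-inj (common-neighbour-unique f₀ f₂ (λ e → contradiction (f-inj e) λ ())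
                      (f∈ (suc zero)) (f∈ (suc (suc (suc zero))))
                      (f~ zero) (Adj-sym (f~ (suc zero))) (Adj-sym closing) (f~ (suc (suc zero)))))
                    λ ()
      where
      f₂ = neighbour-of-backward (neighbour-of-forward f₀ (f∈ (suc zero)) (f~ zero))
                                 (f∈ (suc (suc zero))) (f~ (suc zero))
    ... | inj₂ b₀ =
      contradiction (f-inj (common-neighbour-unique f₁ f₃ (λ e → contradiction (f-inj e) λ ())
                      (f∈ zero) (f∈ (suc (suc zero)))
                      (Adj-sym (f~ zero)) closing (f~ (suc zero)) (Adj-sym (f~ (suc (suc zero))))))
                    λ ()
      where
      f₁ = neighbour-of-backward b₀ (f∈ (suc zero)) (f~ zero)
      f₃ = neighbour-of-backward b₀ (f∈ (suc (suc (suc zero)))) (Adj-sym closing)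

    no-circuit-5 : ¬ Circuit 5
    no-circuit-5 (_ , f , f∈ , _ , f~ , closing) = no-odd-walk 2 s s refl closed
      where
      s = residue-side (f∈ zero)
      closed : Walk (f zero) (f zero) 5
      closed = step (f∈ zero) (f~ zero) (step (f∈ (suc zero)) (f~ (suc zero))
                 (step (f∈ (suc (suc zero))) (f~ (suc (suc zero)))
                 (step (f∈ (suc (suc (suc zero)))) (f~ (suc (suc (suc zero))))
                 (step (f∈ (suc (suc (suc (suc zero))))) closing (here (f∈ zero))))))

    circuit-length≥6 : ∀ n → Circuit n → 6 ≤ n
    circuit-length≥6 0 ()
    circuit-length≥6 1 (s≤s () , _)
    circuit-length≥6 2 (s≤s (s≤s ()) , _)
    circuit-length≥6 3 c = contradiction c no-circuit-3
    circuit-length≥6 4 c = contradiction c no-circuit-4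
    circuit-length≥6 5 c = contradiction c no-circuit-5
    circuit-length≥6 (suc (suc (suc (suc (suc (suc n)))))) _ = ℕ.m≤m+n 6 n

    Within : Elem → Elem → ℕ → Set
    Within y w d = ∃ λ k → k ≤ d × Walk y w k

    within-reverse : ∀ {y w d} → Within y w d → Within w y d
    within-reverse (k , k≤d , wk) = k , k≤d , walk-reverse Adj-sym wk

    within-weaken : ∀ {y w d} → Within y w d → Within y w (suc d)
    within-weaken (k , k≤d , wk) = k , ℕ.m≤n⇒m≤1+n k≤d , wk

    within-step : ∀ {y z w d} → InRes x y → Adj y z → Within z w d → Within y w (suc d)
    within-step y∈ y~z (k , k≤d , wk) = suc k , s≤s k≤d , step y∈ y~z wk

    misses-p : ∀ {a c B} → c I L → c ≢ p → c I B → a I B → ¬ a I L → ¬ p I B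
    misses-p c∈L c≢p c∈B a∈B a∉L p∈B = a∉L (subst (_ I_) (join-unique c≢p c∈B p∈B c∈L p∈L) a∈B)

    forward-at : ∀ {a} → ¬ a I L → Σ Line λ A → Forward (a , A , next i)
    forward-at a∉L with A , p∈A , a∈A ← join (separates-points p∈L a∉L) = A , refl , a∉L , a∈A , p∈A

    backward-neighbour : ∀ {y} → Forward y → ∃ λ z → Backward z × point y I line z
    backward-neighbour {a , A , _} (refl , a∉L , a∈A , p∈A)
      with c , c∈L , c∉A ∷ [] ← avoid L (A ∷ []) (s≤s (s≤s z≤n)) (separates-lines a∈A a∉L ∷ [])
      with B , c∈B , a∈B ← join (separates-points c∈L a∉L)
      = (c , B , next (next i)) ,
        (refl , c∈L , c∈B , misses-p c∈L (separates-points p∈A c∉A ∘ sym) c∈B a∈B a∉L) , a∈B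

    forward-neighbour : ∀ {z} → Backward z → ∃ λ y → Forward y × point y I line z
    forward-neighbour {b , B , _} (refl , b∈L , b∈B , p∉B)
      with a , a∈B , a∉L ∷ [] ← avoid B (L ∷ []) (s≤s (s≤s z≤n)) (separates-lines p∈L p∉B ∷ [])
      with A , fa ← forward-at a∉L
      = (a , A , next i) , fa , a∈B

    -- c avoids L, pa and the line through a that may miss L, so the line ac meets L at b′ ≠ p
    forward-to-backward : ∀ {y w} → Forward y → Backward w → Within y w 3
    forward-to-backward {a , A , _} {b , B , _} fy@(refl , a∉L , a∈A , p∈A) bw@(refl , b∈L , b∈B , p∉B)
      with a I? B
    ... | yes a∈B =
      within-step (forward-in-residue fy) (incident⇒adjacent fy bw a∈B) (0 , z≤n , here (backward-in-residue bw))
    ... | no a∉B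
      with Q , a∈Q , meets-L ← parallel a L
      with c , c∈B , c∉L ∷ c∉A ∷ c∉Q ∷ [] ←
             avoid B (L ∷ A ∷ Q ∷ []) ℕ.≤-refl
               (separates-lines p∈L p∉B ∷ separates-lines p∈A p∉B ∷ separates-lines a∈Q a∉B ∷ [])
      with B′ , a∈B′ , c∈B′ ← join (separates-points c∈B a∉B ∘ sym)
      with b′ , b′∈B′ , b′∈L ← meets-L a∈B′ (separates-lines c∈B′ c∉Q ∘ sym)
      with _ , fc ← forward-at c∉L
      = within-step (forward-in-residue fy) (incident⇒adjacent fy bz a∈B′)
          (within-step (backward-in-residue bz) (Adj-sym (incident⇒adjacent fc bz c∈B′))
            (within-step (forward-in-residue fc) (incident⇒adjacent fc bw c∈B)
              (0 , z≤n , here (backward-in-residue bw))))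
      where
      p∉B′ : ¬ p I B′
      p∉B′ p∈B′ = c∉A (subst (c I_) (join-unique (separates-points p∈L a∉L) p∈B′ a∈B′ p∈A a∈A) c∈B′)
      bz : Backward (b′ , B′ , next (next i))
      bz = refl , b′∈L , b′∈B′ , p∉B′

    walk-bound : ∀ {y w} → InRes x y → InRes x w → Within y w 4
    walk-bound {y} {w} y∈ w∈ = bound (residue-side y∈) (residue-side w∈)
      where
      bound : Side y → Side w → Within y w 4
      bound (inj₁ fy) (inj₂ bw) = within-weaken (forward-to-backward fy bw)
      bound (inj₂ by) (inj₁ fw) = within-weaken (within-reverse (forward-to-backward fw by))
      bound (inj₁ fy) (inj₁ fw) with z , bz , y∈z ← backward-neighbour fy =
        within-step y∈ (incident⇒adjacent fy bz y∈z) (within-reverse (forward-to-backward fw bz))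
      bound (inj₂ by) (inj₂ bw) with v , fv , v∈y ← forward-neighbour by =
        within-step y∈ (Adj-sym (incident⇒adjacent fv by v∈y)) (forward-to-backward fv bw)

    distance-4 : ∀ {y w} → InRes x y → InRes x w → (s : Side y) (t : Side w) → isForward s ≡ isForward t →
                 y ≢ w → (∀ z → InRes x z → Adj y z → Adj z w → ⊥) → Dist≡ y w 4
    distance-4 {y} {w} y∈ w∈ s t same y≢w no-common = exactly-4 (walk-bound y∈ w∈) , shorter
      where
      shorter : ∀ k → k < 4 → ¬ Walk y w k
      shorter 0 _ (here _)                              = y≢w refl
      shorter 1 _ wk                                    = no-odd-walk 0 s t same wk
      shorter 2 _ (step _ y~z (step z∈ z~w (here _)))   = no-common _ z∈ y~z z~w
      shorter 3 _ wk                                    = no-odd-walk 1 s t same wk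
      shorter (suc (suc (suc (suc k)))) (s≤s (s≤s (s≤s (s≤s ())))) _

      exactly-4 : Within y w 4 → Walk y w 4
      exactly-4 (k , k≤4 , wk) with ℕ.≤-antisym k≤4 (ℕ.≮⇒≥ (λ k<4 → shorter k k<4 wk))
      ... | refl = wk

    forward-antipode : ∀ {y} → Forward y → ∃ λ w → Forward w × Dist≡ y w 4
    forward-antipode {a , A , _} fy@(refl , a∉L , a∈A , p∈A)
      with z , bz@(_ , _ , _ , p∉B) , a∈B ← backward-neighbour fy
      with a′ , a′∈A , a′∉L ∷ a′∉B ∷ [] ←
             avoid A (L ∷ line z ∷ []) (s≤s (s≤s (s≤s z≤n)))
               (separates-lines a∈A a∉L ∘ sym ∷ separates-lines p∈A p∉B ∘ sym ∷ [])
      = (a′ , A , next i) , fw ,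
        distance-4 (forward-in-residue fy) (forward-in-residue fw) (inj₁ fy) (inj₁ fw) refl
          (separates-points a∈B a′∉B ∘ cong point) no-common
      where
      fw : Forward (a′ , A , next i)
      fw = refl , a′∉L , a′∈A , p∈A
      no-common : ∀ u → InRes x u → Adj (a , A , next i) u → Adj u (a′ , A , next i) → ⊥
      no-common u u∈ y~u u~w with neighbour-of-forward fy u∈ y~u
      ... | bu@(_ , _ , _ , p∉U) =
        p∉U (subst (p I_) (join-unique (separates-points a∈B a′∉B) a∈A a′∈A
                             (adjacent⇒incident fy bu y~u) (adjacent⇒incident fw bu (Adj-sym u~w))) p∈A)

    backward-antipode : ∀ {z} → Backward z → ∃ λ w → Backward w × Dist≡ z w 4
    backward-antipode {c , B , _} bz@(refl , c∈L , c∈B , p∉B)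
      with y , fy@(_ , a∉L , a∈A , p∈A) , a∈B ← forward-neighbour bz
      with a′ , a′∈A , a′∉L ∷ a′∉B ∷ [] ←
             avoid (line y) (L ∷ B ∷ []) (s≤s (s≤s (s≤s z≤n)))
               (separates-lines a∈A a∉L ∘ sym ∷ separates-lines p∈A p∉B ∘ sym ∷ [])
      with B′ , c∈B′ , a′∈B′ ← join (separates-points c∈L a′∉L)
      = (c , B′ , next (next i)) , bw ,
        distance-4 (backward-in-residue bz) (backward-in-residue bw) (inj₂ bz) (inj₂ bw) refl
          (separates-lines a′∈B′ a′∉B ∘ cong line) no-common
      where
      bw : Backward (c , B′ , next (next i))
      bw = refl , c∈L , c∈B′ , misses-p c∈L (separates-points c∈B p∉B) c∈B′ a′∈B′ a′∉L
      no-common : ∀ u → InRes x u → Adj (c , B , next (next i)) u → Adj u (c , B′ , next (next i)) → ⊥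
      no-common u u∈ z~u u~w with neighbour-of-backward bz u∈ z~u
      ... | fu@(_ , u∉L , _ , _) =
        u∉L (subst (_I L) (sym (meet-unique (separates-lines a′∈B′ a′∉B)
                                  (adjacent⇒incident fu bz (Adj-sym z~u)) (adjacent⇒incident fu bw u~w) c∈B c∈B′)) c∈L)

    -- a₂ avoids the line through c that may miss M, so the line c a₂ meets M
    transversal : ∀ {a c M N} → ¬ a I L → a I M → a I N → N ≢ M → c I L → ¬ c I M → ¬ c I N →
                  ∃₂ λ a₂ a₃ → ∃ λ K → c I K × a₂ I K × a₃ I K × a₂ I N × a₃ I M × ¬ a₂ I L × ¬ a₃ I L × ¬ a₂ I M
    transversal {c = c} {M} {N} a∉L a∈M a∈N N≢M c∈L c∉M c∉N
      with Q , c∈Q , meets-M ← parallel c M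
      with a₂ , a₂∈N , a₂∉L ∷ a₂∉M ∷ a₂∉Q ∷ [] ←
             avoid N (L ∷ M ∷ Q ∷ []) ℕ.≤-refl
               (separates-lines a∈N a∉L ∘ sym ∷ N≢M ∷ separates-lines c∈Q c∉N ∷ [])
      with K , c∈K , a₂∈K ← join (separates-points c∈L a₂∉L)
      with a₃ , a₃∈K , a₃∈M ← meets-M c∈K (separates-lines a₂∈K a₂∉Q ∘ sym)
      = a₂ , a₃ , K , c∈K , a₂∈K , a₃∈K , a₂∈N , a₃∈M , a₂∉L , a₃∉L , a₂∉M
      where
      a₃∉L : ¬ a₃ I L
      a₃∉L a₃∈L = c∉M (subst (_I _) (meet-unique (separates-lines a₂∈K a₂∉L ∘ sym) a₃∈K a₃∈L c∈K c∈L) a₃∈M)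

    alternating-hexagon :
      ∀ {y₁ y₂ y₃ z₁₂ z₂₃ z₃₁} →
      Forward y₁ → Forward y₂ → Forward y₃ → Backward z₁₂ → Backward z₂₃ → Backward z₃₁ →
      point y₁ I line z₁₂ → point y₂ I line z₁₂ → point y₂ I line z₂₃ →
      point y₃ I line z₂₃ → point y₃ I line z₃₁ → point y₁ I line z₃₁ →
      point y₁ ≢ point y₂ → point y₁ ≢ point y₃ → point y₂ ≢ point y₃ →
      point z₁₂ ≢ point z₂₃ → point z₁₂ ≢ point z₃₁ → point z₂₃ ≢ point z₃₁ → Circuit 6
    alternating-hexagon {y₁} {y₂} {y₃} {z₁₂} {z₂₃} {z₃₁} f₁ f₂ f₃ b₁₂ b₂₃ b₃₁
                        y₁∈z₁₂ y₂∈z₁₂ y₂∈z₂₃ y₃∈z₂₃ y₃∈z₃₁ y₁∈z₃₁ y₁≢y₂ y₁≢y₃ y₂≢y₃ z₁₂≢z₂₃ z₁₂≢z₃₁ z₂₃≢z₃₁ =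
      s≤s (s≤s (s≤s z≤n)) , Vec.lookup vertices , lookup⁺ in-residue ,
      (λ {k} {l} → lookup-injective distinct k l) , adjacent , Adj-sym (incident⇒adjacent f₁ b₃₁ y₁∈z₃₁)
      where
      vertices : Vec Elem 6
      vertices = y₁ ∷ z₁₂ ∷ y₂ ∷ z₂₃ ∷ y₃ ∷ z₃₁ ∷ []

      in-residue : VecAll.All (InRes x) vertices
      in-residue = forward-in-residue f₁ ∷ backward-in-residue b₁₂ ∷ forward-in-residue f₂ ∷
                   backward-in-residue b₂₃ ∷ forward-in-residue f₃ ∷ backward-in-residue b₃₁ ∷ []

      adjacent : ∀ k → Adj (Vec.lookup vertices (inject₁ k)) (Vec.lookup vertices (suc k))
      adjacent zero                         = incident⇒adjacent f₁ b₁₂ y₁∈z₁₂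
      adjacent (suc zero)                   = Adj-sym (incident⇒adjacent f₂ b₁₂ y₂∈z₁₂)
      adjacent (suc (suc zero))             = incident⇒adjacent f₂ b₂₃ y₂∈z₂₃
      adjacent (suc (suc (suc zero)))       = Adj-sym (incident⇒adjacent f₃ b₂₃ y₃∈z₂₃)
      adjacent (suc (suc (suc (suc zero)))) = incident⇒adjacent f₃ b₃₁ y₃∈z₃₁

      b≢f : ∀ {z y} → Backward z → Forward y → z ≢ y
      b≢f bz fy = forward≢backward fy bz ∘ sym

      distinct : Unique vertices
      distinct =
        (forward≢backward f₁ b₁₂ ∷ y₁≢y₂ ∘ cong point ∷ forward≢backward f₁ b₂₃ ∷
           y₁≢y₃ ∘ cong point ∷ forward≢backward f₁ b₃₁ ∷ []) ∷
        (b≢f b₁₂ f₂ ∷ z₁₂≢z₂₃ ∘ cong point ∷ b≢f b₁₂ f₃ ∷ z₁₂≢z₃₁ ∘ cong point ∷ []) ∷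
        (forward≢backward f₂ b₂₃ ∷ y₂≢y₃ ∘ cong point ∷ forward≢backward f₂ b₃₁ ∷ []) ∷
        (b≢f b₂₃ f₃ ∷ z₂₃≢z₃₁ ∘ cong point ∷ []) ∷
        (forward≢backward f₃ b₃₁ ∷ []) ∷
        [] ∷ []

    -- a triangle a₁a₂a₃ off L whose sides a₁a₂, a₂a₃, a₃a₁ meet L at c₃, c₁, c₂ ≠ p
    hexagon : Circuit 6
    hexagon
      with a₁ , a₁∉L ← point-off L
      with A₁ , f₁@(_ , _ , a₁∈A₁ , p∈A₁) ← forward-at a₁∉L
      with c₃ , c₃∈L , c₃∉A₁ ∷ [] ← avoid L (A₁ ∷ []) (s≤s (s≤s z≤n)) (separates-lines a₁∈A₁ a₁∉L ∷ [])
      with B₁₂ , c₃∈B₁₂ , a₁∈B₁₂ ← join (separates-points c₃∈L a₁∉L)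
      with c₂ , c₂∈L , c₂∉A₁ ∷ c₂∉B₁₂ ∷ [] ←
             avoid L (A₁ ∷ B₁₂ ∷ []) (s≤s (s≤s (s≤s z≤n)))
               (separates-lines a₁∈A₁ a₁∉L ∷ separates-lines a₁∈B₁₂ a₁∉L ∷ [])
      with B₃₁ , c₂∈B₃₁ , a₁∈B₃₁ ← join (separates-points c₂∈L a₁∉L)
      with c₁ , c₁∈L , c₁∉A₁ ∷ c₁∉B₁₂ ∷ c₁∉B₃₁ ∷ [] ←
             avoid L (A₁ ∷ B₁₂ ∷ B₃₁ ∷ []) ℕ.≤-refl
               (separates-lines a₁∈A₁ a₁∉L ∷ separates-lines a₁∈B₁₂ a₁∉L ∷ separates-lines a₁∈B₃₁ a₁∉L ∷ [])
      with a₂ , a₃ , B₂₃ , c₁∈B₂₃ , a₂∈B₂₃ , a₃∈B₂₃ , a₂∈B₁₂ , a₃∈B₃₁ , a₂∉L , a₃∉L , a₂∉B₃₁ ←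
             transversal a₁∉L a₁∈B₃₁ a₁∈B₁₂ (separates-lines c₂∈B₃₁ c₂∉B₁₂) c₁∈L c₁∉B₃₁ c₁∉B₁₂
      with A₂ , f₂ ← forward-at a₂∉L
      with A₃ , f₃ ← forward-at a₃∉L
      = alternating-hexagon f₁ f₂ f₃ (crossing c₃∈L c₃∉A₁ c₃∈B₁₂ a₁∈B₁₂ a₁∉L)
          (crossing c₁∈L c₁∉A₁ c₁∈B₂₃ a₂∈B₂₃ a₂∉L) (crossing c₂∈L c₂∉A₁ c₂∈B₃₁ a₁∈B₃₁ a₁∉L)
          a₁∈B₁₂ a₂∈B₁₂ a₂∈B₂₃ a₃∈B₂₃ a₃∈B₃₁ a₁∈B₃₁
          a₁≢a₂ a₁≢a₃ (separates-points a₃∈B₃₁ a₂∉B₃₁ ∘ sym)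
          (separates-points c₃∈B₁₂ c₁∉B₁₂) (separates-points c₃∈B₁₂ c₂∉B₁₂) (separates-points c₂∈B₃₁ c₁∉B₃₁ ∘ sym)
      where
      crossing : ∀ {a c B} → c I L → ¬ c I A₁ → c I B → a I B → ¬ a I L → Backward (c , B , next (next i))
      crossing c∈L c∉A₁ c∈B a∈B a∉L = refl , c∈L , c∈B , misses-p c∈L (separates-points p∈A₁ c∉A₁ ∘ sym) c∈B a∈B a∉L

      a₁≢a₂ : a₁ ≢ a₂
      a₁≢a₂ = separates-points a₁∈B₃₁ a₂∉B₃₁

      a₁≢a₃ : a₁ ≢ a₃
      a₁≢a₃ refl = c₁∉B₁₂ (subst (c₁ I_) (join-unique a₁≢a₂ a₃∈B₂₃ a₂∈B₂₃ a₁∈B₁₂ a₂∈B₁₂) c₁∈B₂₃)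

    antipodal-pair : ∀ {t} → t ≡ next i ⊎ t ≡ next (next i) →
                     ∃₂ λ y w → InRes x y × type y ≡ t × InRes x w × Dist≡ y w 4
    antipodal-pair (inj₁ refl)
      with a , a∉L ← point-off L
      with A , fy@(type≡ , _) ← forward-at a∉L
      with w , fw , d ← forward-antipode fy
      = _ , w , forward-in-residue fy , type≡ , forward-in-residue fw , d
    antipodal-pair (inj₂ refl)
      with a , a∉L ← point-off L
      with A , fy ← forward-at a∉L
      with z , bz@(type≡ , _) , _ ← backward-neighbour fy
      with w , bw , d ← backward-antipode bz
      = z , w , backward-in-residue bz , type≡ , backward-in-residue bw , d

    gonality-and-diameters : HasGonality 3 × (∀ t → t ≢ i → HasDiameter (λ y → type y ≡ t) 4)
    gonality-and-diameters =
      (hexagon , circuit-length≥6) ,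
      λ t t≢i → (λ _ _ y∈ _ w∈ → walk-bound y∈ w∈) , antipodal-pair (≢⇒next⊎next² t≢i)

  residue-property : ResidueProperty Γ
  residue-property (p , L , i) p∈L = Residue.gonality-and-diameters p∈L i

-- The library solvers with coefficients in R itself cannot see that an abstract 1# - 1#
-- vanishes; normalising with integer coefficients and interpreting them in R can.
module IntegerCoefficientSolver {c ℓ} (R : CommutativeRing c ℓ) where

  open CommutativeRing R renaming (refl to ≈-refl; sym to ≈-sym; trans to ≈-trans; reflexive to ≈-reflexive)
  open import Algebra.Properties.Ring ring
    using (-‿involutive; -‿+-comm; -0#≈0#; -1*x≈-x)
  open import Algebra.Properties.Semiring.Mult.TCOptimised semiring
    using (×-homo-+; ×1-homo-*; 1+×) renaming (_×_ to _×ᴿ_)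
  open import Algebra.Properties.CommutativeSemigroup *-commutativeSemigroup
    using (interchange)
  open import Relation.Binary.Reasoning.Setoid setoid

  ⟦_⟧ℤ : ℤ → Carrier
  ⟦ + n ⟧ℤ      = n ×ᴿ 1#
  ⟦ -[1+ n ] ⟧ℤ = - (suc n ×ᴿ 1#)

  private
    +-cancelˡ-− : ∀ x a b → (x + a) - (x + b) ≈ a - b
    +-cancelˡ-− x a b = begin
      (x + a) + - (x + b)    ≈⟨ +-congˡ (-‿+-comm x b) ⟨
      (x + a) + (- x + - b)  ≈⟨ +-assoc x a _ ⟩
      x + (a + (- x + - b))  ≈⟨ +-congˡ (+-congˡ (+-comm (- x) (- b))) ⟩
      x + (a + (- b + - x))  ≈⟨ +-congˡ (+-assoc a (- b) (- x)) ⟨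
      x + ((a - b) + - x)    ≈⟨ +-congˡ (+-comm (a - b) (- x)) ⟩
      x + (- x + (a - b))    ≈⟨ +-assoc x (- x) _ ⟨
      (x - x) + (a - b)      ≈⟨ +-congʳ (-‿inverseʳ x) ⟩
      0# + (a - b)           ≈⟨ +-identityˡ _ ⟩
      a - b                  ∎

    ⊖-homo : ∀ m n → ⟦ m ⊖ n ⟧ℤ ≈ m ×ᴿ 1# - n ×ᴿ 1#
    ⊖-homo zero    zero    = ≈-sym (-‿inverseʳ 0#)
    ⊖-homo zero    (suc n) = ≈-sym (+-identityˡ _)
    ⊖-homo (suc m) zero    = ≈-sym (≈-trans (+-congˡ -0#≈0#) (+-identityʳ _))
    ⊖-homo (suc m) (suc n) = begin
      ⟦ suc m ⊖ suc n ⟧ℤ                 ≡⟨ cong ⟦_⟧ℤ (ℤ.[1+m]⊖[1+n]≡m⊖n m n) ⟩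
      ⟦ m ⊖ n ⟧ℤ                         ≈⟨ ⊖-homo m n ⟩
      m ×ᴿ 1# - n ×ᴿ 1#                  ≈⟨ +-cancelˡ-− 1# _ _ ⟨
      (1# + m ×ᴿ 1#) - (1# + n ×ᴿ 1#)    ≈⟨ +-cong (1+× m 1#) (-‿cong (1+× n 1#)) ⟨
      suc m ×ᴿ 1# - suc n ×ᴿ 1#          ∎

    +-homo : ∀ i j → ⟦ i ℤ.+ j ⟧ℤ ≈ ⟦ i ⟧ℤ + ⟦ j ⟧ℤ
    +-homo (+ m)    (+ n)    = ×-homo-+ 1# m n
    +-homo (+ m)    -[1+ n ] = ⊖-homo m (suc n)
    +-homo -[1+ m ] (+ n)    = ≈-trans (⊖-homo n (suc m)) (+-comm _ _)
    +-homo -[1+ m ] -[1+ n ] = begin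
      - (suc (suc (m ℕ.+ n)) ×ᴿ 1#)       ≡⟨ cong (λ k → - (suc k ×ᴿ 1#)) (ℕ.+-suc m n) ⟨
      - ((suc m ℕ.+ suc n) ×ᴿ 1#)         ≈⟨ -‿cong (×-homo-+ 1# (suc m) (suc n)) ⟩
      - (suc m ×ᴿ 1# + suc n ×ᴿ 1#)       ≈⟨ -‿+-comm _ _ ⟨
      - (suc m ×ᴿ 1#) + - (suc n ×ᴿ 1#)   ∎

    sign⟦_⟧ : Sign → Carrier
    sign⟦ Sign.+ ⟧ = 1#
    sign⟦ Sign.- ⟧ = - 1#

    sign-homo : ∀ s t → sign⟦ s Sign.* t ⟧ ≈ sign⟦ s ⟧ * sign⟦ t ⟧
    sign-homo Sign.+ t      = ≈-sym (*-identityˡ _)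
    sign-homo Sign.- Sign.+ = ≈-sym (*-identityʳ _)
    sign-homo Sign.- Sign.- = begin
      1#           ≈⟨ -‿involutive 1# ⟨
      - (- 1#)     ≈⟨ -1*x≈-x (- 1#) ⟨
      - 1# * - 1#  ∎

    ◃-homo : ∀ s n → ⟦ s ◃ n ⟧ℤ ≈ sign⟦ s ⟧ * (n ×ᴿ 1#)
    ◃-homo s      zero    = ≈-sym (zeroʳ _)
    ◃-homo Sign.+ (suc n) = ≈-sym (*-identityˡ _)
    ◃-homo Sign.- (suc n) = ≈-sym (-1*x≈-x _)

    sign-abs : ∀ i → ⟦ i ⟧ℤ ≈ sign⟦ ℤ.sign i ⟧ * (ℤ.∣ i ∣ ×ᴿ 1#)
    sign-abs i = begin
      ⟦ i ⟧ℤ                              ≡⟨ cong ⟦_⟧ℤ (ℤ.◃-inverse i) ⟨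
      ⟦ ℤ.sign i ◃ ℤ.∣ i ∣ ⟧ℤ             ≈⟨ ◃-homo (ℤ.sign i) ℤ.∣ i ∣ ⟩
      sign⟦ ℤ.sign i ⟧ * (ℤ.∣ i ∣ ×ᴿ 1#)  ∎

    *-homo : ∀ i j → ⟦ i ℤ.* j ⟧ℤ ≈ ⟦ i ⟧ℤ * ⟦ j ⟧ℤ
    *-homo i j = begin
      ⟦ (ℤ.sign i Sign.* ℤ.sign j) ◃ (ℤ.∣ i ∣ ℕ.* ℤ.∣ j ∣) ⟧ℤ
        ≈⟨ ◃-homo (ℤ.sign i Sign.* ℤ.sign j) (ℤ.∣ i ∣ ℕ.* ℤ.∣ j ∣) ⟩
      sign⟦ ℤ.sign i Sign.* ℤ.sign j ⟧ * ((ℤ.∣ i ∣ ℕ.* ℤ.∣ j ∣) ×ᴿ 1#)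
        ≈⟨ *-cong (sign-homo (ℤ.sign i) (ℤ.sign j)) (×1-homo-* ℤ.∣ i ∣ ℤ.∣ j ∣) ⟩
      (s * t) * (m * n)
        ≈⟨ interchange s t m n ⟩
      (s * m) * (t * n)
        ≈⟨ *-cong (sign-abs i) (sign-abs j) ⟨
      ⟦ i ⟧ℤ * ⟦ j ⟧ℤ ∎
      where
      s = sign⟦ ℤ.sign i ⟧
      t = sign⟦ ℤ.sign j ⟧
      m = ℤ.∣ i ∣ ×ᴿ 1#
      n = ℤ.∣ j ∣ ×ᴿ 1#

    -‿homo : ∀ i → ⟦ ℤ.- i ⟧ℤ ≈ - ⟦ i ⟧ℤ
    -‿homo (+ zero)  = ≈-sym -0#≈0#
    -‿homo (+ suc n) = ≈-refl
    -‿homo -[1+ n ]  = ≈-sym (-‿involutive _)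

  ℤ⟶R : +-*-rawRing -Raw-AlmostCommutative⟶ fromCommutativeRing R
  ℤ⟶R = record
    { ⟦_⟧    = ⟦_⟧ℤ
    ; +-homo = +-homo
    ; *-homo = *-homo
    ; -‿homo = -‿homo
    ; 0-homo = ≈-refl
    ; 1-homo = ≈-refl
    }

  open import Algebra.Solver.Ring +-*-rawRing (fromCommutativeRing R) ℤ⟶R
    (λ i j → map (λ i≡j → ≈-reflexive (cong ⟦_⟧ℤ i≡j)) (dec⇒maybe (i ℤ.≟ j)))
    public

  :0 :1 : ∀ {n} → Polynomial n
  :0 = con 0ℤ
  :1 = con 1ℤ

module FiniteFieldProperties {q} (F : FiniteField q) where
  -- Defs gives the field operations no fixities
  open FiniteField F public renaming (_+_ to infixl 6 _+_; _·_ to infixl 7 _·_; -_ to infix 8 -_)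

  commutativeRing : CommutativeRing _ _
  commutativeRing = record { isCommutativeRing = isCommutativeRing }

  open CommutativeRing commutativeRing public using (_-_; +-identityʳ; -‿inverseʳ; zeroʳ; *-comm)
  open import Algebra.Properties.Ring (CommutativeRing.ring commutativeRing) public
    using (x∙y⁻¹≈ε⇒x≈y; x≈y⇒x∙y⁻¹≈ε; +-cancelˡ)
  open IntegerCoefficientSolver commutativeRing public
    using (solve; _:=_; _:+_; _:*_; _:-_; :-_; :0; :1)
  open ≡-Reasoning

  private
    module Enum = Injection (↔⇒↣ enum)

  infix 4 _≟_
  _≟_ : DecidableEquality Carrier
  _≟_ = via-injection (↔⇒↣ (↔-sym enum)) Fin._≟_

  element : ∀ {k} → k ≤ q → Fin k → Carrier
  element k≤q j = Enum.to (inject≤ j k≤q)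

  element-injective : ∀ {k} (k≤q : k ≤ q) → Injective _≡_ _≡_ (element k≤q)
  element-injective k≤q = Fin.inject≤-injective k≤q k≤q _ _ ∘ Enum.injective

  1≢0 : 1# ≢ 0#
  1≢0 = 0≢1 ∘ sym

  no-zero-divisors : ∀ {a b} → a · b ≡ 0# → a ≡ 0# ⊎ b ≡ 0#
  no-zero-divisors {a} {b} ab≡0 with a ≟ 0#
  ... | yes a≡0 = inj₁ a≡0
  ... | no  a≢0 with a⁻¹ , aa⁻¹≡1 ← inverse a a≢0 = inj₂ (begin
    b               ≡⟨ solve 3 (λ a b a⁻¹ → b := (a⁻¹ :* (a :* b)) :+ (:1 :- a :* a⁻¹) :* b) refl a b a⁻¹ ⟩
    a⁻¹ · (a · b) + (1# - a · a⁻¹) · b  ≡⟨ cong₂ (λ u v → a⁻¹ · u + (1# - v) · b) ab≡0 aa⁻¹≡1 ⟩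
    a⁻¹ · 0# + (1# - 1#) · b            ≡⟨ solve 2 (λ a⁻¹ b → a⁻¹ :* :0 :+ (:1 :- :1) :* b := :0) refl a⁻¹ b ⟩
    0#              ∎)

module AffinePlane {q} (F : FiniteField q) (4≤q : 4 ≤ q) where
  open FiniteFieldProperties F
  open PLGeometry (AG F)
  open ≡-Reasoning

  join : ∀ {a b} → a ≢ b → Σ Line λ M → a I M × b I M
  join {x₁ , y₁} {x₂ , y₂} a≢b with x₁ ≟ x₂
  ... | yes x₁≡x₂ = inj₂ x₁ , refl , sym x₁≡x₂
  ... | no  x₁≢x₂ with w , dw ← inverse (x₂ - x₁) (x₁≢x₂ ∘ sym ∘ x∙y⁻¹≈ε⇒x≈y x₂ x₁) =
    inj₁ (m , y₁ - m · x₁) , on₁ , on₂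
    where
    m = (y₂ - y₁) · w
    on₁ : y₁ ≡ m · x₁ + (y₁ - m · x₁)
    on₁ = solve 2 (λ y₁ mx₁ → y₁ := mx₁ :+ (y₁ :- mx₁)) refl y₁ (m · x₁)
    on₂ : y₂ ≡ m · x₂ + (y₁ - m · x₁)
    on₂ = sym (begin
      m · x₂ + (y₁ - m · x₁)             ≡⟨ solve 5 (λ x₁ x₂ y₁ y₂ w →
                                              (y₂ :- y₁) :* w :* x₂ :+ (y₁ :- (y₂ :- y₁) :* w :* x₁)
                                              := (y₂ :- y₁) :* ((x₂ :- x₁) :* w) :+ y₁) refl x₁ x₂ y₁ y₂ w ⟩
      (y₂ - y₁) · ((x₂ - x₁) · w) + y₁   ≡⟨ cong (λ t → (y₂ - y₁) · t + y₁) dw ⟩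
      (y₂ - y₁) · 1# + y₁                ≡⟨ solve 2 (λ y₁ y₂ → (y₂ :- y₁) :* :1 :+ y₁ := y₂) refl y₁ y₂ ⟩
      y₂                                 ∎)

  sloped-abscissa-determines : ∀ {x₁ y₁ x₂ y₂ m k} → (x₁ , y₁) I inj₁ (m , k) → (x₂ , y₂) I inj₁ (m , k) →
                               x₁ ≡ x₂ → (x₁ , y₁) ≡ (x₂ , y₂)
  sloped-abscissa-determines a∈M b∈M refl = cong (_ ,_) (trans a∈M (sym b∈M))

  slope-gap : ∀ {x₁ y₁ x₂ y₂ m k m′ k′} →
              (x₁ , y₁) I inj₁ (m , k) → (x₂ , y₂) I inj₁ (m , k) →
              (x₁ , y₁) I inj₁ (m′ , k′) → (x₂ , y₂) I inj₁ (m′ , k′) → (m - m′) · (x₁ - x₂) ≡ 0#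
  slope-gap {x₁} {y₁} {x₂} {y₂} {m} {k} {m′} {k′} a∈M b∈M a∈N b∈N = begin
    (m - m′) · (x₁ - x₂)
      ≡⟨ solve 6 (λ m m′ k k′ x₁ x₂ → (m :- m′) :* (x₁ :- x₂)
                    := (m :* x₁ :+ k :- (m′ :* x₁ :+ k′)) :- (m :* x₂ :+ k :- (m′ :* x₂ :+ k′))) refl m m′ k k′ x₁ x₂ ⟩
    (m · x₁ + k - (m′ · x₁ + k′)) - (m · x₂ + k - (m′ · x₂ + k′))
      ≡⟨ cong₂ _-_ (x≈y⇒x∙y⁻¹≈ε (trans (sym a∈M) a∈N)) (x≈y⇒x∙y⁻¹≈ε (trans (sym b∈M) b∈N)) ⟩
    0# - 0#
      ≡⟨ -‿inverseʳ 0# ⟩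
    0# ∎

  same-slope : ∀ {x₁ y₁ x₂ y₂ m k m′ k′} → x₁ ≢ x₂ →
               (x₁ , y₁) I inj₁ (m , k) → (x₂ , y₂) I inj₁ (m , k) →
               (x₁ , y₁) I inj₁ (m′ , k′) → (x₂ , y₂) I inj₁ (m′ , k′) → m ≡ m′
  same-slope {x₁} {_} {x₂} {_} {m} {_} {m′} x₁≢x₂ a∈M b∈M a∈N b∈N =
    [ x∙y⁻¹≈ε⇒x≈y m m′ , (λ x₁-x₂≡0 → contradiction (x∙y⁻¹≈ε⇒x≈y x₁ x₂ x₁-x₂≡0) x₁≢x₂) ]′
      (no-zero-divisors (slope-gap a∈M b∈M a∈N b∈N))

  join-unique : ∀ {a b M N} → a ≢ b → a I M → b I M → a I N → b I N → M ≡ N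
  join-unique {M = inj₂ _} {inj₂ _} _ a∈M _ a∈N _ = cong inj₂ (trans (sym a∈M) a∈N)
  join-unique {M = inj₂ _} {inj₁ _} a≢b a∈M b∈M a∈N b∈N =
    contradiction (sloped-abscissa-determines a∈N b∈N (trans a∈M (sym b∈M))) a≢b
  join-unique {M = inj₁ _} {inj₂ _} a≢b a∈M b∈M a∈N b∈N =
    contradiction (sloped-abscissa-determines a∈M b∈M (trans a∈N (sym b∈N))) a≢b
  join-unique {x₁ , _} {x₂ , _} {inj₁ (m , k)} {inj₁ (m′ , k′)} a≢b a∈M b∈M a∈N b∈N with x₁ ≟ x₂
  ... | yes x₁≡x₂ = contradiction (sloped-abscissa-determines a∈M b∈M x₁≡x₂) a≢b
  ... | no  x₁≢x₂ = cong₂ (λ m c → inj₁ (m , c)) m≡m′ (+-cancelˡ (m · x₁) k k′ (begin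
    m · x₁ + k     ≡⟨ trans (sym a∈M) a∈N ⟩
    m′ · x₁ + k′   ≡⟨ cong (λ s → s · x₁ + k′) m≡m′ ⟨
    m · x₁ + k′    ∎))
    where
    m≡m′ : m ≡ m′
    m≡m′ = same-slope x₁≢x₂ a∈M b∈M a∈N b∈N

  parallel : ∀ a K → Σ Line λ Q → a I Q × (∀ {M} → a I M → M ≢ Q → ∃ λ b → b I M × b I K)
  parallel (a₁ , a₂) (inj₂ c) = inj₂ a₁ , refl , meets
    where
    meets : ∀ {M} → (a₁ , a₂) I M → M ≢ inj₂ a₁ → ∃ λ b → b I M × b I inj₂ c
    meets {inj₁ (m′ , k′)} _ _      = (c , m′ · c + k′) , refl , refl
    meets {inj₂ _}         a∈M M≢Q = contradiction (cong inj₂ (sym a∈M)) M≢Q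
  parallel (a₁ , a₂) (inj₁ (m , k)) = inj₁ (m , a₂ - m · a₁) , a∈Q , meets
    where
    a∈Q : a₂ ≡ m · a₁ + (a₂ - m · a₁)
    a∈Q = solve 2 (λ a₂ ma₁ → a₂ := ma₁ :+ (a₂ :- ma₁)) refl a₂ (m · a₁)

    meets : ∀ {M} → (a₁ , a₂) I M → M ≢ inj₁ (m , a₂ - m · a₁) → ∃ λ b → b I M × b I inj₁ (m , k)
    meets {inj₂ c} _ _ = (c , m · c + k) , refl , refl
    meets {inj₁ (m′ , k′)} a∈M M≢Q with m′ ≟ m
    ... | yes refl = contradiction (cong (λ c → inj₁ (m , c)) (+-cancelˡ (m · a₁) k′ _ (trans (sym a∈M) a∈Q))) M≢Q
    ... | no  m′≢m with w , dw ← inverse (m′ - m) (m′≢m ∘ x∙y⁻¹≈ε⇒x≈y m′ m) =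
      (x , m · x + k) , sym (x∙y⁻¹≈ε⇒x≈y _ _ crossing) , refl
      where
      x = (k - k′) · w
      crossing : m′ · x + k′ - (m · x + k) ≡ 0#
      crossing = begin
        m′ · x + k′ - (m · x + k)            ≡⟨ solve 5 (λ m m′ k k′ w →
                                                  m′ :* ((k :- k′) :* w) :+ k′ :- (m :* ((k :- k′) :* w) :+ k)
                                                  := (k :- k′) :* ((m′ :- m) :* w) :+ (k′ :- k)) refl m m′ k k′ w ⟩
        (k - k′) · ((m′ - m) · w) + (k′ - k) ≡⟨ cong (λ t → (k - k′) · t + (k′ - k)) dw ⟩
        (k - k′) · 1# + (k′ - k)             ≡⟨ solve 2 (λ k k′ → (k :- k′) :* :1 :+ (k′ :- k) := :0) refl k k′ ⟩
        0#                                   ∎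

  four-points : ∀ M → Σ (Fin 4 → Point) λ f → (∀ j → f j I M) × Injective _≡_ _≡_ f
  four-points (inj₁ (m , k)) =
    (λ j → element 4≤q j , m · element 4≤q j + k) , (λ _ → refl) , element-injective 4≤q ∘ cong proj₁
  four-points (inj₂ c) =
    (λ j → c , element 4≤q j) , (λ _ → refl) , element-injective 4≤q ∘ cong proj₂

  point-off : ∀ M → ∃ λ a → ¬ a I M
  point-off (inj₁ (m , k)) =
    (0# , k + 1#) , λ a∈M → 1≢0 (+-cancelˡ k 1# 0# (trans a∈M (solve 2 (λ m k → m :* :0 :+ k := k :+ :0) refl m k)))
  point-off (inj₂ c) =
    (c + 1# , 0#) , λ a∈M → 1≢0 (+-cancelˡ c 1# 0# (trans a∈M (sym (+-identityʳ c))))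

  affine-plane : PlaneAxioms (AG F)
  affine-plane = record
    { _≟_         = ×.≡-dec _≟_ _≟_
    ; _I?_        = λ { (x , y) (inj₁ (m , k)) → y ≟ m · x + k ; (x , _) (inj₂ c) → x ≟ c }
    ; join        = join
    ; join-unique = join-unique
    ; parallel    = parallel
    ; four-points = four-points
    ; point-off   = point-off
    }

module ProjectivePlane {q} (F : FiniteField q) (3≤q : 3 ≤ q) where
  open FiniteFieldProperties F
  open PLGeometry (PG F)
  open ≡-Reasoning

  Vector : Set
  Vector = Carrier × Carrier × Carrier

  coords : ProjRep Carrier → Vector
  coords (inj₁ (a , b))   = 1# , a , b
  coords (inj₂ (inj₁ a))  = 0# , 1# , a
  coords (inj₂ (inj₂ tt)) = 0# , 0# , 1#

  infix 7 _∙_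
  _∙_ : Vector → Vector → Carrier
  (x₀ , x₁ , x₂) ∙ (y₀ , y₁ , y₂) = x₀ · y₀ + x₁ · y₁ + x₂ · y₂

  infixr 8 _⨯_
  _⨯_ : Vector → Vector → Vector
  (x₀ , x₁ , x₂) ⨯ (y₀ , y₁ , y₂) = x₁ · y₂ - x₂ · y₁ , x₂ · y₀ - x₀ · y₂ , x₀ · y₁ - x₁ · y₀

  infixr 8 _⊛_
  _⊛_ : Carrier → Vector → Vector
  l ⊛ (v₀ , v₁ , v₂) = l · v₀ , l · v₁ , l · v₂

  IsZero : Vector → Set
  IsZero (v₀ , v₁ , v₂) = v₀ ≡ 0# × v₁ ≡ 0# × v₂ ≡ 0#

  -- Defs computes incidence with its own coordinate map, which only unfolds on constructors
  incidence : ∀ p L → p I L ≡ (coords p ∙ coords L ≡ 0#)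
  incidence (inj₁ _)         (inj₁ _)         = refl
  incidence (inj₁ _)         (inj₂ (inj₁ _))  = refl
  incidence (inj₁ _)         (inj₂ (inj₂ tt)) = refl
  incidence (inj₂ (inj₁ _))  (inj₁ _)         = refl
  incidence (inj₂ (inj₁ _))  (inj₂ (inj₁ _))  = refl
  incidence (inj₂ (inj₁ _))  (inj₂ (inj₂ tt)) = refl
  incidence (inj₂ (inj₂ tt)) (inj₁ _)         = refl
  incidence (inj₂ (inj₂ tt)) (inj₂ (inj₁ _))  = refl
  incidence (inj₂ (inj₂ tt)) (inj₂ (inj₂ tt)) = refl

  ∙⇒I : ∀ p L → coords p ∙ coords L ≡ 0# → p I L
  ∙⇒I p L = subst (λ A → A) (sym (incidence p L))

  I⇒∙ : ∀ p L → p I L → coords p ∙ coords L ≡ 0#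
  I⇒∙ p L = subst (λ A → A) (incidence p L)

  ∙-comm : ∀ u v → u ∙ v ≡ v ∙ u
  ∙-comm (u₀ , u₁ , u₂) (v₀ , v₁ , v₂) =
    solve 6 (λ u₀ u₁ u₂ v₀ v₁ v₂ → u₀ :* v₀ :+ u₁ :* v₁ :+ u₂ :* v₂ := v₀ :* u₀ :+ v₁ :* u₁ :+ v₂ :* u₂)
      refl u₀ u₁ u₂ v₀ v₁ v₂

  ∙-⨯ˡ : ∀ u v l → u ∙ l ⊛ (u ⨯ v) ≡ 0#
  ∙-⨯ˡ (u₀ , u₁ , u₂) (v₀ , v₁ , v₂) l =
    solve 7 (λ u₀ u₁ u₂ v₀ v₁ v₂ l →
               u₀ :* (l :* (u₁ :* v₂ :- u₂ :* v₁)) :+ u₁ :* (l :* (u₂ :* v₀ :- u₀ :* v₂))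
                 :+ u₂ :* (l :* (u₀ :* v₁ :- u₁ :* v₀))
               := :0)
      refl u₀ u₁ u₂ v₀ v₁ v₂ l

  ∙-⨯ʳ : ∀ u v l → v ∙ l ⊛ (u ⨯ v) ≡ 0#
  ∙-⨯ʳ (u₀ , u₁ , u₂) (v₀ , v₁ , v₂) l =
    solve 7 (λ u₀ u₁ u₂ v₀ v₁ v₂ l →
               v₀ :* (l :* (u₁ :* v₂ :- u₂ :* v₁)) :+ v₁ :* (l :* (u₂ :* v₀ :- u₀ :* v₂))
                 :+ v₂ :* (l :* (u₀ :* v₁ :- u₁ :* v₀))
               := :0)
      refl u₀ u₁ u₂ v₀ v₁ v₂ l

  -- m ⨯ (u ⨯ v) = (v ∙ m) ⊛ u - (u ∙ m) ⊛ v
  ⨯-⨯-zero : ∀ m u v l → u ∙ m ≡ 0# → v ∙ m ≡ 0# → IsZero (m ⨯ l ⊛ (u ⨯ v))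
  ⨯-⨯-zero m@(m₀ , m₁ , m₂) u@(u₀ , u₁ , u₂) v@(v₀ , v₁ , v₂) l u∙m≡0 v∙m≡0 =
    component u₀ v₀
      (solve 10 (λ m₀ m₁ m₂ u₀ u₁ u₂ v₀ v₁ v₂ l →
                   m₁ :* (l :* (u₀ :* v₁ :- u₁ :* v₀)) :- m₂ :* (l :* (u₂ :* v₀ :- u₀ :* v₂))
                   := l :* (u₀ :* (v₀ :* m₀ :+ v₁ :* m₁ :+ v₂ :* m₂) :- v₀ :* (u₀ :* m₀ :+ u₁ :* m₁ :+ u₂ :* m₂)))
         refl m₀ m₁ m₂ u₀ u₁ u₂ v₀ v₁ v₂ l) ,
    component u₁ v₁
      (solve 10 (λ m₀ m₁ m₂ u₀ u₁ u₂ v₀ v₁ v₂ l →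
                   m₂ :* (l :* (u₁ :* v₂ :- u₂ :* v₁)) :- m₀ :* (l :* (u₀ :* v₁ :- u₁ :* v₀))
                   := l :* (u₁ :* (v₀ :* m₀ :+ v₁ :* m₁ :+ v₂ :* m₂) :- v₁ :* (u₀ :* m₀ :+ u₁ :* m₁ :+ u₂ :* m₂)))
         refl m₀ m₁ m₂ u₀ u₁ u₂ v₀ v₁ v₂ l) ,
    component u₂ v₂
      (solve 10 (λ m₀ m₁ m₂ u₀ u₁ u₂ v₀ v₁ v₂ l →
                   m₀ :* (l :* (u₂ :* v₀ :- u₀ :* v₂)) :- m₁ :* (l :* (u₁ :* v₂ :- u₂ :* v₁))
                   := l :* (u₂ :* (v₀ :* m₀ :+ v₁ :* m₁ :+ v₂ :* m₂) :- v₂ :* (u₀ :* m₀ :+ u₁ :* m₁ :+ u₂ :* m₂)))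
         refl m₀ m₁ m₂ u₀ u₁ u₂ v₀ v₁ v₂ l)
    where
    component : ∀ {c} a b → c ≡ l · (a · (v ∙ m) - b · (u ∙ m)) → c ≡ 0#
    component a b c≡ = begin
      _                                ≡⟨ c≡ ⟩
      l · (a · (v ∙ m) - b · (u ∙ m))  ≡⟨ cong₂ (λ s t → l · (a · s - b · t)) v∙m≡0 u∙m≡0 ⟩
      l · (a · 0# - b · 0#)            ≡⟨ solve 3 (λ l a b → l :* (a :* :0 :- b :* :0) := :0) refl l a b ⟩
      0#                               ∎

  normalise : ∀ v → ¬ IsZero v → ∃ λ r → ∃ λ l → coords r ≡ l ⊛ v
  normalise (v₀ , v₁ , v₂) v≢0 with v₀ ≟ 0# | v₁ ≟ 0# | v₂ ≟ 0#
  ... | no v₀≢0 | _ | _ with w , v₀w≡1 ← inverse v₀ v₀≢0 =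
    inj₁ (w · v₁ , w · v₂) , w , cong (_, _) (sym (trans (*-comm w v₀) v₀w≡1))
  ... | yes refl | no v₁≢0 | _ with w , v₁w≡1 ← inverse v₁ v₁≢0 =
    inj₂ (inj₁ (w · v₂)) , w , cong₂ _,_ (sym (zeroʳ w)) (cong (_, _) (sym (trans (*-comm w v₁) v₁w≡1)))
  ... | yes refl | yes refl | no v₂≢0 with w , v₂w≡1 ← inverse v₂ v₂≢0 =
    inj₂ (inj₂ tt) , w , cong₂ _,_ (sym (zeroʳ w)) (cong₂ _,_ (sym (zeroʳ w)) (sym (trans (*-comm w v₂) v₂w≡1)))
  ... | yes v₀≡0 | yes v₁≡0 | yes v₂≡0 = contradiction (v₀≡0 , v₁≡0 , v₂≡0) v≢0

  -1≢0 : - 1# ≢ 0#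
  -1≢0 -1≡0 = 1≢0 (begin
    1#        ≡⟨ solve 0 (:1 := :- :- :1) refl ⟩
    - - 1#    ≡⟨ cong -_ -1≡0 ⟩
    - 0#      ≡⟨ solve 0 (:- :0 := :0) refl ⟩
    0#        ∎)

  proportional⇒≡ : ∀ u w → IsZero (coords u ⨯ coords w) → u ≡ w
  proportional⇒≡ (inj₁ (a , b)) (inj₁ (c , d)) (_ , b-d≡0 , c-a≡0) =
    cong inj₁ (cong₂ _,_
      (sym (x∙y⁻¹≈ε⇒x≈y c a (trans (solve 2 (λ a c → c :- a := :1 :* c :- a :* :1) refl a c) c-a≡0)))
      (x∙y⁻¹≈ε⇒x≈y b d (trans (solve 2 (λ b d → b :- d := b :* :1 :- :1 :* d) refl b d) b-d≡0)))
  proportional⇒≡ (inj₁ (a , b)) (inj₂ (inj₁ c)) (_ , _ , 1≡0) =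
    contradiction (trans (solve 1 (λ a → :1 := :1 :* :1 :- a :* :0) refl a) 1≡0) 1≢0
  proportional⇒≡ (inj₁ (a , b)) (inj₂ (inj₂ tt)) (_ , -1≡0 , _) =
    contradiction (trans (solve 1 (λ b → :- :1 := b :* :0 :- :1 :* :1) refl b) -1≡0) -1≢0
  proportional⇒≡ (inj₂ (inj₁ a)) (inj₁ (c , d)) (_ , _ , -1≡0) =
    contradiction (trans (solve 1 (λ c → :- :1 := :0 :* c :- :1 :* :1) refl c) -1≡0) -1≢0
  proportional⇒≡ (inj₂ (inj₁ a)) (inj₂ (inj₁ c)) (c-a≡0 , _) =
    cong (inj₂ ∘ inj₁)
      (sym (x∙y⁻¹≈ε⇒x≈y c a (trans (solve 2 (λ a c → c :- a := :1 :* c :- a :* :1) refl a c) c-a≡0)))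
  proportional⇒≡ (inj₂ (inj₁ a)) (inj₂ (inj₂ tt)) (1≡0 , _) =
    contradiction (trans (solve 1 (λ a → :1 := :1 :* :1 :- a :* :0) refl a) 1≡0) 1≢0
  proportional⇒≡ (inj₂ (inj₂ tt)) (inj₁ (c , d)) (_ , 1≡0 , _) =
    contradiction (trans (solve 1 (λ d → :1 := :1 :* :1 :- :0 :* d) refl d) 1≡0) 1≢0
  proportional⇒≡ (inj₂ (inj₂ tt)) (inj₂ (inj₁ c)) (-1≡0 , _) =
    contradiction (trans (solve 1 (λ c → :- :1 := :0 :* c :- :1 :* :1) refl c) -1≡0) -1≢0
  proportional⇒≡ (inj₂ (inj₂ tt)) (inj₂ (inj₂ tt)) _ = refl

  I-sym : ∀ p L → p I L → L I p
  I-sym p L p∈L = ∙⇒I L p (trans (∙-comm (coords L) (coords p)) (I⇒∙ p L p∈L))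

  line-through : ∀ {a b} → a ≢ b → ∃ λ r → ∃ λ l → coords r ≡ l ⊛ (coords a ⨯ coords b)
  line-through {a} {b} a≢b = normalise (coords a ⨯ coords b) (a≢b ∘ proportional⇒≡ a b)

  join : ∀ {a b} → a ≢ b → Σ Line λ M → a I M × b I M
  join {a} {b} a≢b with r , l , r≡ ← line-through a≢b =
    r , ∙⇒I a r (trans (cong (coords a ∙_) r≡) (∙-⨯ˡ _ _ l)) , ∙⇒I b r (trans (cong (coords b ∙_) r≡) (∙-⨯ʳ _ _ l))

  join-unique : ∀ {a b M N} → a ≢ b → a I M → b I M → a I N → b I N → M ≡ N
  join-unique {a} {b} a≢b a∈M b∈M a∈N b∈N with r , l , r≡ ← line-through a≢b =
    trans (through-a-b a∈M b∈M) (sym (through-a-b a∈N b∈N))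
    where
    through-a-b : ∀ {K} → a I K → b I K → K ≡ r
    through-a-b {K} a∈K b∈K =
      proportional⇒≡ K r (subst (IsZero ∘ (coords K ⨯_)) (sym r≡) (⨯-⨯-zero _ _ _ l (I⇒∙ a K a∈K) (I⇒∙ b K b∈K)))

  four-points-from : ∀ M (g : Carrier → Point) → Injective _≡_ _≡_ g → (∀ t → g t I M) →
                     ∀ r → r I M → (∀ t → g t ≢ r) → Σ (Fin 4 → Point) λ f → (∀ j → f j I M) × Injective _≡_ _≡_ f
  four-points-from M g g-inj g∈M r r∈M g≢r = f , f∈M , f-inj
    where
    f : Fin 4 → Point
    f zero    = r
    f (suc j) = g (element 3≤q j)

    f∈M : ∀ j → f j I M
    f∈M zero    = r∈M
    f∈M (suc j) = g∈M (element 3≤q j)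

    f-inj : Injective _≡_ _≡_ f
    f-inj {zero}  {zero}  _   = refl
    f-inj {zero}  {suc k} r≡g = contradiction (sym r≡g) (g≢r _)
    f-inj {suc j} {zero}  g≡r = contradiction g≡r (g≢r _)
    f-inj {suc j} {suc k} g≡g = cong suc (element-injective 3≤q (g-inj g≡g))

  vanishes : ∀ {e u w} c → e ≡ c · (1# - u · w) → u · w ≡ 1# → e ≡ 0#
  vanishes c e≡ uw≡1 = begin
    _                  ≡⟨ e≡ ⟩
    c · (1# - _)       ≡⟨ cong (λ s → c · (1# - s)) uw≡1 ⟩
    c · (1# - 1#)      ≡⟨ solve 1 (λ c → c :* (:1 :- :1) := :0) refl c ⟩
    0#                 ∎

  four-points : ∀ M → Σ (Fin 4 → Point) λ f → (∀ j → f j I M) × Injective _≡_ _≡_ f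
  four-points M@(inj₂ (inj₂ tt)) =
    four-points-from M (λ t → inj₁ (t , 0#)) (λ { refl → refl })
      (λ t → solve 1 (λ t → :1 :* :0 :+ t :* :0 :+ :0 :* :1 := :0) refl t)
      (inj₂ (inj₁ 0#)) (solve 0 (:0 :* :0 :+ :1 :* :0 :+ :0 :* :1 := :0) refl) (λ _ ())
  four-points M@(inj₂ (inj₁ a)) with a ≟ 0#
  ... | yes refl =
    four-points-from M (λ t → inj₁ (0# , t)) (λ { refl → refl })
      (λ t → solve 1 (λ t → :1 :* :0 :+ :0 :* :1 :+ t :* :0 := :0) refl t)
      (inj₂ (inj₂ tt)) (solve 0 (:0 :* :0 :+ :0 :* :1 :+ :1 :* :0 := :0) refl) (λ _ ())
  ... | no a≢0 with w , aw≡1 ← inverse a a≢0 =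
    four-points-from M (λ t → inj₁ (- (a · t) , t)) (λ { refl → refl })
      (λ t → solve 2 (λ a t → :1 :* :0 :+ :- (a :* t) :* :1 :+ t :* a := :0) refl a t)
      (inj₂ (inj₁ (- w)))
      (vanishes 1# (solve 2 (λ a w → :0 :* :0 :+ :1 :* :1 :+ :- w :* a
                                    := :1 :* (:1 :- a :* w)) refl a w) aw≡1)
      (λ _ ())
  four-points M@(inj₁ (a , b)) with b ≟ 0# | a ≟ 0#
  ... | no b≢0 | _ with w , bw≡1 ← inverse b b≢0 =
    four-points-from M (λ t → inj₁ (t , - ((1# + a · t) · w))) (λ { refl → refl })
      (λ t → vanishes (1# + a · t)
               (solve 4 (λ a b t w → :1 :* :1 :+ t :* a :+ :- ((:1 :+ a :* t) :* w) :* b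
                                    := (:1 :+ a :* t) :* (:1 :- b :* w)) refl a b t w) bw≡1)
      (inj₂ (inj₁ (- (a · w))))
      (vanishes a (solve 3 (λ a b w → :0 :* :1 :+ :1 :* a :+ :- (a :* w) :* b
                                    := a :* (:1 :- b :* w)) refl a b w) bw≡1)
      (λ _ ())
  ... | yes refl | yes refl =
    four-points-from M (λ t → inj₂ (inj₁ t)) (λ { refl → refl })
      (λ t → solve 1 (λ t → :0 :* :1 :+ :1 :* :0 :+ t :* :0 := :0) refl t)
      (inj₂ (inj₂ tt)) (solve 0 (:0 :* :1 :+ :0 :* :0 :+ :1 :* :0 := :0) refl) (λ _ ())
  ... | yes refl | no a≢0 with w , aw≡1 ← inverse a a≢0 =
    four-points-from M (λ t → inj₁ (- w , t)) (λ { refl → refl })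
      (λ t → vanishes 1# (solve 3 (λ a t w → :1 :* :1 :+ :- w :* a :+ t :* :0
                                           := :1 :* (:1 :- a :* w)) refl a t w) aw≡1)
      (inj₂ (inj₂ tt)) (solve 1 (λ a → :0 :* :1 :+ :0 :* a :+ :1 :* :0 := :0) refl a) (λ _ ())

  infix 4 _≟ᴾ_
  _≟ᴾ_ : DecidableEquality (ProjRep Carrier)
  _≟ᴾ_ = ⊎.≡-dec (×.≡-dec _≟_ _≟_) (⊎.≡-dec _≟_ ⊤._≟_)

  point-on : ∀ M → ∃ λ b → b I M
  point-on M = let f , f∈M , _ = four-points M in f zero , f∈M zero

  lines-meet : ∀ M K → ∃ λ b → b I M × b I K
  lines-meet M K with M ≟ᴾ K
  ... | yes refl = let b , b∈M = point-on M in b , b∈M , b∈M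
  ... | no  M≢K  = let b , M∈b , K∈b = join M≢K in b , I-sym M b M∈b , I-sym K b K∈b

  parallel : ∀ a K → Σ Line λ Q → a I Q × (∀ {M} → a I M → M ≢ Q → ∃ λ b → b I M × b I K)
  parallel a K = let Q , a∈Q = point-on a in Q , I-sym Q a a∈Q , λ {M} _ _ → lines-meet M K

  point-off : ∀ M → ∃ λ a → ¬ a I M
  point-off (inj₁ (a , b)) =
    inj₁ (0# , 0#) , λ a∈M → 1≢0 (trans (solve 2 (λ a b → :1 := :1 :* :1 :+ :0 :* a :+ :0 :* b) refl a b) a∈M)
  point-off (inj₂ (inj₁ a)) =
    inj₂ (inj₁ 0#) , λ a∈M → 1≢0 (trans (solve 1 (λ a → :1 := :0 :* :0 :+ :1 :* :1 :+ :0 :* a) refl a) a∈M)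
  point-off (inj₂ (inj₂ tt)) =
    inj₂ (inj₂ tt) , λ a∈M → 1≢0 (trans (solve 0 (:1 := :0 :* :0 :+ :0 :* :0 :+ :1 :* :1) refl) a∈M)

  projective-plane : PlaneAxioms (PG F)
  projective-plane = record
    { _≟_         = _≟ᴾ_
    ; _I?_        = λ p L → subst Dec (sym (incidence p L)) (coords p ∙ coords L ≟ 0#)
    ; join        = join
    ; join-unique = join-unique
    ; parallel    = parallel
    ; four-points = four-points
    ; point-off   = point-off
    }

corollary5p4 : ((q : ℕ) (F : FiniteField q) → 4 ≤ q → ResidueProperty (AG F))
             × ((q : ℕ) (F : FiniteField q) → 3 ≤ q → ResidueProperty (PG F))
corollary5p4 = (λ q F 4≤q → PlaneProperties.residue-property (AffinePlane.affine-plane F 4≤q))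
             , (λ q F 3≤q → PlaneProperties.residue-property (ProjectivePlane.projective-plane F 3≤q))
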